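{- There is a polynomial $p$ such that for every $n\ge 2$ the formula $\textsc{EQ}'_n$ has an $\mathrm{OBDD}(\land,\exists,\forall)$-refutation of size at most $p(n)$.
   Context: $\textsc{EQ}'_n := \exists x_1\ldots\exists x_n\forall u_1\ldots\forall u_n\exists t_1\ldots\exists t_n\exists e_1\ldots\exists e_n.\ \bigwedge_{i=1}^n\big((x_i\lor u_i\lor\neg t_i)\land(\neg x_i\lor\neg u_i\lor\neg t_i)\big)\land(t_1\lor e_1)\land\bigwedge_{i=2}^{n-1}(\neg e_{i-1}\lor t_i\lor e_i)\land(\neg e_{n-1}\lor t_n)$. For a PCNF $\Phi=Q_1x_1\ldots Q_nx_n.\,C_1\land\dots\land C_m$, an $\mathrm{OBDD}(\land,\exists,\forall)$ derivation from $\Phi$ is a sequence $L_1,\dots,L_k$ of OBDDs (ordered binary decision diagrams) all using the same variable order, where $L_i$ represents $C_i$ for $i\le m$ and each other $L_i$ is obtained by conjunction ($L_i$ represents $L_j\land L_{j'}$, $j,j'<i$), projection ($L_i$ represents $\exists x.L_j$ for a variable $x$ of $L_j$, $j<i$), or universal reduction ($L_i$ represents $L_j[u/c]$, $j<i$, $u$ universal and rightmost in the prefix among the variables of $L_j$, $c\in\{0,1\}$). Its size is the sum of the numbers of nodes of its OBDDs; a refutation ends with an OBDD representing the constant $0$. -}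

module Defs where

open import Data.Nat using (ℕ; zero; suc; _+_; _*_; _∸_; _^_; _≤_; _<_)
open import Data.Bool using (Bool; true; false; if_then_else_; _∧_; _∨_; not)
open import Data.Fin using (Fin; zero; suc)
open import Data.Maybe using (Maybe; just; nothing)
open import Data.List using (List; []; _∷_; _++_; map; concatMap; upTo; length)
open import Data.Bool.ListAction using (any)
open import Data.Nat.ListAction using (sum)
open import Data.List.Membership.Propositional using (_∈_)
open import Data.List.Relation.Binary.Pointwise using (Pointwise)
open import Data.List.Relation.Unary.All using (All)
open import Data.Product using (Σ; _×_; _,_; ∃)
open import Data.Unit using (⊤)
open import Relation.Binary.PropositionalEquality using (_≡_)
open import Relation.Nullary.Decidable using (⌊_⌋)
open import Data.Nat using (_≟_; _<ᵇ_)
open import Function.Definitions using (Injective)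

-- Assignments, literals, clauses, PCNFs
-- Variables are natural numbers; in a PCNF the variable v sits at
-- position v of the quantifier prefix (prefix order = numeric order).

Assignment : Set
Assignment = ℕ → Bool

_[_≔_] : Assignment → ℕ → Bool → Assignment
(α [ x ≔ c ]) y = if ⌊ y ≟ x ⌋ then c else α y

data Literal : Set where
  pos : ℕ → Literal
  neg : ℕ → Literal

evalLit : Literal → Assignment → Bool
evalLit (pos v) α = α v
evalLit (neg v) α = not (α v)

Clause : Set
Clause = List Literal

evalClause : Clause → Assignment → Bool
evalClause C α = any (λ l → evalLit l α) C

data Quant : Set where
  ∃q ∀q : Quant

record PCNF : Set where
  field
    quant  : ℕ → Quant
    matrix : List Clause
open PCNF public

-- OBDDs as DAGs with sharing.  A value of 'Nodes k' is a list of k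
-- nodes; the head node may only point to nodes of the tail (so the
-- graph is acyclic).  The root is the head node.

data Node (k : ℕ) : Set where
  leaf   : Bool → Node k
  branch : (v : ℕ) (lo hi : Fin k) → Node k   -- lo: v = 0, hi: v = 1

data Nodes : ℕ → Set where
  []  : Nodes 0
  _∷_ : ∀ {k} → Node k → Nodes k → Nodes (suc k)

evalAt : ∀ {k} → Nodes k → Fin k → Assignment → Bool
evalAt (leaf b ∷ ns) zero α = b
evalAt (branch v lo hi ∷ ns) zero α = if α v then evalAt ns hi α else evalAt ns lo α
evalAt (_ ∷ ns) (suc i) α = evalAt ns i α

varAt : ∀ {k} → Nodes k → Fin k → Maybe ℕ
varAt (leaf b ∷ ns) zero = nothing
varAt (branch v lo hi ∷ ns) zero = just v
varAt (_ ∷ ns) (suc i) = varAt ns i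

-- variable order given by an (injective) rank function ρ:
-- x precedes y iff ρ x < ρ y
ChildOK : (ℕ → ℕ) → ℕ → Maybe ℕ → Set
ChildOK ρ v nothing  = ⊤
ChildOK ρ v (just w) = ρ v < ρ w

OrderedNodes : (ℕ → ℕ) → ∀ {k} → Nodes k → Set
OrderedNodes ρ [] = ⊤
OrderedNodes ρ (leaf b ∷ ns) = OrderedNodes ρ ns
OrderedNodes ρ (branch v lo hi ∷ ns) =
  ChildOK ρ v (varAt ns lo) × ChildOK ρ v (varAt ns hi) × OrderedNodes ρ ns

data _∈Nodes_ (x : ℕ) : ∀ {k} → Nodes k → Set where
  here  : ∀ {k} {lo hi : Fin k} {ns : Nodes k} → x ∈Nodes (branch x lo hi ∷ ns)
  there : ∀ {k} {n : Node k} {ns : Nodes k} → x ∈Nodes ns → x ∈Nodes (n ∷ ns)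

record OBDD : Set where
  constructor obdd
  field
    pred  : ℕ
    nodes : Nodes (suc pred)
open OBDD public

size : OBDD → ℕ
size L = suc (pred L)

⟦_⟧ : OBDD → Assignment → Bool
⟦ L ⟧ = evalAt (nodes L) zero

Ordered : (ℕ → ℕ) → OBDD → Set
Ordered ρ L = OrderedNodes ρ (nodes L)

_∈Vars_ : ℕ → OBDD → Set
x ∈Vars L = x ∈Nodes (nodes L)

Represents : OBDD → (Assignment → Bool) → Set
Represents L f = ∀ α → ⟦ L ⟧ α ≡ f α

data Justified (Φ : PCNF) (E : List OBDD) (L : OBDD) : Set where
  conj : ∀ {L₁ L₂} → L₁ ∈ E → L₂ ∈ E →
         Represents L (λ α → ⟦ L₁ ⟧ α ∧ ⟦ L₂ ⟧ α) → Justified Φ E L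
  proj : ∀ {L₁} x → L₁ ∈ E → x ∈Vars L₁ →
         Represents L (λ α → ⟦ L₁ ⟧ (α [ x ≔ false ]) ∨ ⟦ L₁ ⟧ (α [ x ≔ true ])) →
         Justified Φ E L
  ured : ∀ {L₁} u (c : Bool) → L₁ ∈ E → u ∈Vars L₁ → quant Φ u ≡ ∀q →
         (∀ y → y ∈Vars L₁ → y ≤ u) →
         Represents L (λ α → ⟦ L₁ ⟧ (α [ u ≔ c ])) → Justified Φ E L

data Steps (Φ : PCNF) : List OBDD → List OBDD → Set where
  done : ∀ {E} → Steps Φ E []
  step : ∀ {E L Ls} → Justified Φ E L → Steps Φ (E ++ (L ∷ [])) Ls →
         Steps Φ E (L ∷ Ls)

record Derivation (Φ : PCNF) : Set where
  field
    ρ        : ℕ → ℕ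
    ρ-inj    : Injective _≡_ _≡_ ρ
    axioms   : List OBDD
    derived  : List OBDD
    axiomsOK : Pointwise (λ L C → Represents L (evalClause C)) axioms (matrix Φ)
    stepsOK  : Steps Φ axioms derived
    ordered  : All (Ordered ρ) (axioms ++ derived)
open Derivation public

lines : ∀ {Φ} → Derivation Φ → List OBDD
lines D = axioms D ++ derived D

derivationSize : ∀ {Φ} → Derivation Φ → ℕ
derivationSize D = sum (map size (lines D))

IsRefutation : ∀ {Φ} → Derivation Φ → Set
IsRefutation D = Σ (List OBDD) λ init → Σ OBDD λ L →
  (init ++ (L ∷ [])) ≡ lines D × Represents L (λ _ → false)

-- Polynomials (coefficient lists, constant term first)

Poly : Set
Poly = List ℕ

evalPoly : Poly → ℕ → ℕ
evalPoly [] x = 0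
evalPoly (a ∷ as) x = a + x * evalPoly as x

-- EQ'_n.  Variables (0-based j = i-1):
--   x_i = j, u_i = n + j, t_i = 2n + j, e_i = 3n + j,
-- prefix ∃x ∀u ∃t ∃e in this numeric order.

EQ'quant : ℕ → ℕ → Quant
EQ'quant n v = if v <ᵇ n then ∃q else (if v <ᵇ 2 * n then ∀q else ∃q)

EQ'matrix : ℕ → List Clause
EQ'matrix n =
  concatMap (λ j → (pos (x j) ∷ pos (u j) ∷ neg (t j) ∷ [])
                 ∷ (neg (x j) ∷ neg (u j) ∷ neg (t j) ∷ []) ∷ []) (upTo n)
  ++ ((pos (t 0) ∷ pos (e 0) ∷ []) ∷ [])
  ++ map (λ k → neg (e k) ∷ pos (t (suc k)) ∷ pos (e (suc k)) ∷ []) (upTo (n ∸ 2))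
  ++ ((neg (e (n ∸ 2)) ∷ pos (t (n ∸ 1)) ∷ []) ∷ [])
  where
    x u t e : ℕ → ℕ
    x j = j
    u j = n + j
    t j = 2 * n + j
    e j = 3 * n + j

EQ' : ℕ → PCNF
EQ' n = record { quant = EQ'quant n ; matrix = EQ'matrix n }

module Submission where

-- Order the variables block by block, x₁ u₁ t₁ e₁ x₂ u₂ …. Sweeping the blocks from the last to
-- the first, conjoining each block's clauses and projecting away its t and e, computes ∃t∃e of the
-- matrix, that is ⋁ᵢ (xᵢ ≠ uᵢ), as an OBDD in which every block is a layer of five nodes shared
-- by the later lines. Universally reducing uₙ to 0 and to 1 gives D ∨ xₙ and D ∨ ¬xₙ with
-- D = ⋁_{i<n} (xᵢ ≠ uᵢ), whose conjunction is D; after n rounds the constant 0 remains.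
-- There are 11n − 2 lines of at most 5n + 40 nodes each.

open import Defs
open import Data.Bool using (Bool; true; false; if_then_else_; _∧_; _∨_; not; _xor_; T)
import Data.Bool.Properties as Boolₚ
open import Data.Fin using (Fin; zero; suc)
open import Data.List using (List; []; _∷_; _++_; map; concatMap; upTo; length)
open import Data.List.Membership.Propositional using (_∈_)
open import Data.List.Membership.Propositional.Properties using (∈-++⁺ˡ; ∈-++⁺ʳ; ∈-map⁺; ∈-upTo⁺; ∈-concat⁺′)
open import Data.List.Properties using (++-assoc; length-++; length-map; length-upTo)
open import Data.List.Relation.Binary.Pointwise using (Pointwise; []; _∷_)
open import Data.List.Relation.Binary.Subset.Propositional using (_⊆_)
import Data.List.Relation.Binary.Subset.Propositional.Properties as ⊆
open import Data.List.Relation.Unary.All as All using (All; []; _∷_)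
import Data.List.Relation.Unary.All.Properties as All
open import Data.List.Relation.Unary.Any using (here; there)
open import Data.List.Relation.Unary.Linked as Linked using (Linked; [-]; _∷_)
open import Data.Maybe using (Maybe; just; nothing)
open import Data.Vec using (Vec; []; _∷_)
open import Data.Vec.Relation.Binary.Pointwise.Inductive using ([]; _∷_; Pointwise-≡⇒≡)
open import Data.Nat using (ℕ; zero; suc; _+_; _*_; _≤_; _<_; _<ᵇ_; _≟_; z≤n; s≤s; s≤s⁻¹; z<s; NonZero)
open import Data.Nat.DivMod using (_%_; [m+kn]%n≡m%n; m<n⇒m%n≡m)
open import Data.Nat.ListAction using (sum)
open import Data.Nat.Properties
open import Data.Nat.Tactic.RingSolver using (solve-∀)
open import Data.Product using (Σ; _×_; _,_; proj₁; proj₂)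
open import Data.Sum using (_⊎_; inj₁; inj₂)
open import Data.Unit using (⊤; tt)
open import Function using (_∘_; _on_; Equivalence)
open import Function.Definitions using (Injective)
open import Relation.Binary.PropositionalEquality
open import Relation.Nullary using (Dec; yes; no; ¬_; contradiction)
open import Relation.Nullary.Decidable using (True; map′; _×-dec_; toWitness)

-- Templates: decision trees whose hole points to a shared node

data Template : Set where
  const : Bool → Template
  hole  : Template
  test  : (v : ℕ) (lo hi : Template) → Template

above : Template → ℕ → ℕ
above (const b)      k = suc k
above hole           k = k
above (test v lo hi) k = suc (above lo (above hi k))

weaken : ∀ t {k} → Fin (suc k) → Fin (suc (above t k))
weaken (const b)      i = suc i
weaken hole           i = i
weaken (test v lo hi) i = suc (weaken lo (weaken hi i))

root : ∀ t {k} → Fin (suc k) → Fin (suc (above t k))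
root (const b)      c = zero
root hole           c = c
root (test v lo hi) c = zero

attach : ∀ t {k} → Nodes (suc k) → Fin (suc k) → Nodes (suc (above t k))
attach (const b)      ns c = leaf b ∷ ns
attach hole           ns c = ns
attach (test v lo hi) ns c =
  branch v (root lo (weaken hi c)) (weaken lo (root hi c)) ∷ attach lo (attach hi ns c) (weaken hi c)

_⊳_ : ∀ {k} → Template → Nodes (suc k) → OBDD
t ⊳ ns = obdd (above t _) (attach t ns zero)

above-+ : ∀ t k → above t k ≡ above t 0 + k
above-+ (const b)      k = refl
above-+ hole           k = refl
above-+ (test v lo hi) k = cong suc (begin
  above lo (above hi k)               ≡⟨ above-+ lo (above hi k) ⟩
  above lo 0 + above hi k             ≡⟨ cong (above lo 0 +_) (above-+ hi k) ⟩
  above lo 0 + (above hi 0 + k)       ≡⟨ sym (+-assoc (above lo 0) (above hi 0) k) ⟩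
  above lo 0 + above hi 0 + k         ≡⟨ cong (_+ k) (sym (above-+ lo (above hi 0))) ⟩
  above lo (above hi 0) + k           ∎)
  where open ≡-Reasoning

evalᵗ : Template → Bool → Assignment → Bool
evalᵗ (const b)      r α = b
evalᵗ hole           r α = r
evalᵗ (test v lo hi) r α = if α v then evalᵗ hi r α else evalᵗ lo r α

module _ where
  private variable
    k : ℕ

  evalAt-weaken : ∀ t (ns : Nodes (suc k)) c i α →
                  evalAt (attach t ns c) (weaken t i) α ≡ evalAt ns i α
  evalAt-weaken (const b)      ns c i α = refl
  evalAt-weaken hole           ns c i α = refl
  evalAt-weaken (test v lo hi) ns c i α =
    trans (evalAt-weaken lo (attach hi ns c) (weaken hi c) (weaken hi i) α) (evalAt-weaken hi ns c i α)

  evalAt-root : ∀ t (ns : Nodes (suc k)) c α →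
                evalAt (attach t ns c) (root t c) α ≡ evalᵗ t (evalAt ns c α) α
  evalAt-root (const b)      ns c α = refl
  evalAt-root hole           ns c α = refl
  evalAt-root (test v lo hi) ns c α = cong₂ (if_then_else_ (α v))
    (trans (evalAt-weaken lo (attach hi ns c) (weaken hi c) (root hi c) α) (evalAt-root hi ns c α))
    (trans (evalAt-root lo (attach hi ns c) (weaken hi c) α)
           (cong (λ r → evalᵗ lo r α) (evalAt-weaken hi ns c c α)))

  root-zero : ∀ t → root t {k} zero ≡ zero
  root-zero (const b)      = refl
  root-zero hole           = refl
  root-zero (test v lo hi) = refl

  ⟦⊳⟧ : ∀ t (ns : Nodes (suc k)) α → ⟦ t ⊳ ns ⟧ α ≡ evalᵗ t (evalAt ns zero α) α
  ⟦⊳⟧ t ns α = subst (λ i → evalAt (attach t ns zero) i α ≡ evalᵗ t (evalAt ns zero α) α)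
                      (root-zero t) (evalAt-root t ns zero α)

  varAt-weaken : ∀ t (ns : Nodes (suc k)) c i → varAt (attach t ns c) (weaken t i) ≡ varAt ns i
  varAt-weaken (const b)      ns c i = refl
  varAt-weaken hole           ns c i = refl
  varAt-weaken (test v lo hi) ns c i =
    trans (varAt-weaken lo (attach hi ns c) (weaken hi c) (weaken hi i)) (varAt-weaken hi ns c i)

  rootVar : Template → Maybe ℕ → Maybe ℕ
  rootVar (const b)      w = nothing
  rootVar hole           w = w
  rootVar (test v lo hi) w = just v

  varAt-root : ∀ t (ns : Nodes (suc k)) c → varAt (attach t ns c) (root t c) ≡ rootVar t (varAt ns c)
  varAt-root (const b)      ns c = refl
  varAt-root hole           ns c = refl
  varAt-root (test v lo hi) ns c = refl

-- w is the variable tested at the node the hole points to (nothing for a leaf).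
OrderedTemplate : (ℕ → ℕ) → Maybe ℕ → Template → Set
OrderedTemplate ρ w (const b)      = ⊤
OrderedTemplate ρ w hole           = ⊤
OrderedTemplate ρ w (test v lo hi) =
  ChildOK ρ v (rootVar lo w) × ChildOK ρ v (rootVar hi w) ×
  OrderedTemplate ρ w lo × OrderedTemplate ρ w hi

attach-ordered : ∀ ρ t {k} (ns : Nodes (suc k)) c → OrderedNodes ρ ns →
                 OrderedTemplate ρ (varAt ns c) t → OrderedNodes ρ (attach t ns c)
attach-ordered ρ (const b) ns c ons ot = ons
attach-ordered ρ hole      ns c ons ot = ons
attach-ordered ρ (test v lo hi) ns c ons (olo , ohi , tlo , thi) =
  subst (ChildOK ρ v) (sym lo-var) olo ,
  subst (ChildOK ρ v) (sym hi-var) ohi ,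
  attach-ordered ρ lo (attach hi ns c) (weaken hi c) (attach-ordered ρ hi ns c ons thi)
    (subst (λ w → OrderedTemplate ρ w lo) (sym (varAt-weaken hi ns c c)) tlo)
  where
    lo-var = trans (varAt-root lo (attach hi ns c) (weaken hi c)) (cong (rootVar lo) (varAt-weaken hi ns c c))
    hi-var = trans (varAt-weaken lo (attach hi ns c) (weaken hi c) (root hi c)) (varAt-root hi ns c)

⊳-ordered : ∀ ρ t {k} {ns : Nodes (suc k)} → OrderedNodes ρ ns → OrderedTemplate ρ (varAt ns zero) t →
            Ordered ρ (t ⊳ ns)
⊳-ordered ρ t = attach-ordered ρ t _ zero

data Tests (x : ℕ) : Template → Set where
  at-root : ∀ {lo hi} → Tests x (test x lo hi)
  in-lo   : ∀ {v lo hi} → Tests x lo → Tests x (test v lo hi)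
  in-hi   : ∀ {v lo hi} → Tests x hi → Tests x (test v lo hi)

module _ {x : ℕ} where
  ∈-attach⁺ʳ : ∀ t {k} (ns : Nodes (suc k)) c → x ∈Nodes ns → x ∈Nodes attach t ns c
  ∈-attach⁺ʳ (const b)      ns c p = there p
  ∈-attach⁺ʳ hole           ns c p = p
  ∈-attach⁺ʳ (test v lo hi) ns c p =
    there (∈-attach⁺ʳ lo (attach hi ns c) (weaken hi c) (∈-attach⁺ʳ hi ns c p))

  ∈-attach⁺ˡ : ∀ t {k} (ns : Nodes (suc k)) c → Tests x t → x ∈Nodes attach t ns c
  ∈-attach⁺ˡ (test v lo hi) ns c at-root   = here
  ∈-attach⁺ˡ (test v lo hi) ns c (in-lo p) = there (∈-attach⁺ˡ lo (attach hi ns c) (weaken hi c) p)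
  ∈-attach⁺ˡ (test v lo hi) ns c (in-hi p) =
    there (∈-attach⁺ʳ lo (attach hi ns c) (weaken hi c) (∈-attach⁺ˡ hi ns c p))

  ∈-attach⁻ : ∀ t {k} (ns : Nodes (suc k)) c → x ∈Nodes attach t ns c → Tests x t ⊎ x ∈Nodes ns
  ∈-attach⁻ (const b)      ns c (there p) = inj₂ p
  ∈-attach⁻ hole           ns c p         = inj₂ p
  ∈-attach⁻ (test v lo hi) ns c here      = inj₁ at-root
  ∈-attach⁻ (test v lo hi) ns c (there p) with ∈-attach⁻ lo (attach hi ns c) (weaken hi c) p
  ... | inj₁ q = inj₁ (in-lo q)
  ... | inj₂ q with ∈-attach⁻ hi ns c q
  ...   | inj₁ r = inj₁ (in-hi r)
  ...   | inj₂ r = inj₂ r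

⊤ᵗ ⊥ᵗ : Template
⊤ᵗ = const true
⊥ᵗ = const false

var⁺ var⁻ : ℕ → Template
var⁺ v = test v ⊥ᵗ ⊤ᵗ
var⁻ v = test v ⊤ᵗ ⊥ᵗ

ifEq : ℕ → ℕ → (same diff : Template) → Template
ifEq v w same diff = test v (test w same diff) (test w diff same)

ifEq-ordered : ∀ ρ {w′} v w same diff → ChildOK ρ v (just w) →
               ChildOK ρ w (rootVar same w′) → ChildOK ρ w (rootVar diff w′) →
               OrderedTemplate ρ w′ same → OrderedTemplate ρ w′ diff →
               OrderedTemplate ρ w′ (ifEq v w same diff)
ifEq-ordered ρ v w same diff v≺w w≺s w≺d os od = v≺w , v≺w , (w≺s , w≺d , os , od) , (w≺d , w≺s , od , os)

falseLeaf : Nodes 1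
falseLeaf = leaf false ∷ []

litVar : Literal → ℕ
litVar (pos v) = v
litVar (neg v) = v

clauseTemplate : Clause → Template
clauseTemplate []          = ⊥ᵗ
clauseTemplate (pos v ∷ C) = test v (clauseTemplate C) ⊤ᵗ
clauseTemplate (neg v ∷ C) = test v ⊤ᵗ (clauseTemplate C)

clauseTemplate-sem : ∀ C r α → evalᵗ (clauseTemplate C) r α ≡ evalClause C α
clauseTemplate-sem []          r α = refl
clauseTemplate-sem (pos v ∷ C) r α with α v
... | true  = refl
... | false = clauseTemplate-sem C r α
clauseTemplate-sem (neg v ∷ C) r α with α v
... | true  = clauseTemplate-sem C r α
... | false = refl

RankSorted : (ℕ → ℕ) → Clause → Set
RankSorted ρ = Linked (_<_ on (ρ ∘ litVar))

clauseTemplate-root-ordered : ∀ ρ {w l} C → RankSorted ρ (l ∷ C) →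
                              ChildOK ρ (litVar l) (rootVar (clauseTemplate C) w)
clauseTemplate-root-ordered ρ []          _         = tt
clauseTemplate-root-ordered ρ (pos _ ∷ C) (l≺ ∷ _) = l≺
clauseTemplate-root-ordered ρ (neg _ ∷ C) (l≺ ∷ _) = l≺

clauseTemplate-ordered : ∀ ρ {w} C → RankSorted ρ C → OrderedTemplate ρ w (clauseTemplate C)
clauseTemplate-ordered ρ []          sorted = tt
clauseTemplate-ordered ρ (pos v ∷ C) sorted =
  clauseTemplate-root-ordered ρ C sorted , tt , clauseTemplate-ordered ρ C (Linked.tail sorted) , tt
clauseTemplate-ordered ρ (neg v ∷ C) sorted =
  tt , clauseTemplate-root-ordered ρ C sorted , tt , clauseTemplate-ordered ρ C (Linked.tail sorted)

clauseOBDD : Clause → OBDD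
clauseOBDD C = clauseTemplate C ⊳ falseLeaf

clauseOBDDs-represent : ∀ M → Pointwise (λ L C → Represents L (evalClause C)) (map clauseOBDD M) M
clauseOBDDs-represent []      = []
clauseOBDDs-represent (C ∷ M) =
  (λ α → trans (⟦⊳⟧ (clauseTemplate C) falseLeaf α) (clauseTemplate-sem C false α)) ∷ clauseOBDDs-represent M

slot : ∀ {k} → Vec Bool k → Assignment
slot []       i       = false
slot (b ∷ bs) zero    = b
slot (b ∷ bs) (suc i) = slot bs i

Semantics : Set
Semantics = Bool → Assignment → Bool

_∧ᵗ_ : Template → Template → Semantics
(τ ∧ᵗ τ′) r α = evalᵗ τ r α ∧ evalᵗ τ′ r α

∃ᵗ : ℕ → Template → Semantics
∃ᵗ v τ r α = evalᵗ τ r (α [ v ≔ false ]) ∨ evalᵗ τ r (α [ v ≔ true ])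

_⟪_⟫ : Template → Template → Template
const b      ⟪ τ′ ⟫ = const b
hole         ⟪ τ′ ⟫ = τ′
test v lo hi ⟪ τ′ ⟫ = test v (lo ⟪ τ′ ⟫) (hi ⟪ τ′ ⟫)

-- An identity checked at the variables 0 … k − 1
-- under slot bs applies to an instance at other variables by taking for bs their values: both
-- sides then normalise to the same Boolean expression.
record Identity (k : ℕ) (f g : Semantics) : Set where
  constructor holds
  field
    at : ∀ r (bs : Vec Bool k) → f r (slot bs) ≡ g r (slot bs)
open Identity

∀-Bool? : {P : Bool → Set} → (∀ b → Dec (P b)) → Dec (∀ b → P b)
∀-Bool? P? = map′ (λ (p , q) → λ { true → p ; false → q }) (λ h → h true , h false)
                  (P? true ×-dec P? false)

∀-Vec? : ∀ k {P : Vec Bool k → Set} → (∀ bs → Dec (P bs)) → Dec (∀ bs → P bs)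
∀-Vec? zero    P? = map′ (λ p → λ { [] → p }) (λ h → h []) (P? [])
∀-Vec? (suc k) P? = map′ (λ h → λ { (b ∷ bs) → h b bs }) (λ h b bs → h (b ∷ bs))
                         (∀-Bool? λ b → ∀-Vec? k λ bs → P? (b ∷ bs))

identity? : ∀ k f g → Dec (Identity k f g)
identity? k f g = map′ holds at (∀-Bool? λ r → ∀-Vec? k λ bs → f r (slot bs) Boolₚ.≟ g r (slot bs))

by-cases : ∀ k {f g} → True (identity? k f g) → Identity k f g
by-cases k = toWitness

if-not≡xor : ∀ a z → (if a then not z else z) ≡ a xor z
if-not≡xor true  z = refl
if-not≡xor false z = refl

∨-xor-split : ∀ s a → s ∨ false ≡ (s ∨ (a xor false)) ∧ (s ∨ (a xor true))
∨-xor-split s true  = sym (cong (_∧ (s ∨ false)) (Boolₚ.∨-zeroʳ s))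
∨-xor-split s false = sym (trans (cong ((s ∨ false) ∧_) (Boolₚ.∨-zeroʳ s)) (Boolₚ.∧-identityʳ _))

≔-same : ∀ α v z → (α [ v ≔ z ]) v ≡ z
≔-same α v z with v ≟ v
... | yes _   = refl
... | no v≢v = contradiction refl v≢v

≔-other : ∀ α {v w} z → w ≢ v → (α [ v ≔ z ]) w ≡ α w
≔-other α {v} {w} z w≢v with w ≟ v
... | yes w≡v = contradiction w≡v w≢v
... | no _    = refl

<ᵇ-true : ∀ {a b} → a < b → (a <ᵇ b) ≡ true
<ᵇ-true a<b = Equivalence.to Boolₚ.T-≡ (<⇒<ᵇ a<b)

<ᵇ-false : ∀ {a b} → ¬ a < b → (a <ᵇ b) ≡ false
<ᵇ-false {a} {b} a≮b = Boolₚ.¬-not (λ eq → a≮b (<ᵇ⇒< a b (Equivalence.from Boolₚ.T-≡ eq)))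

∈-last : ∀ E {L : OBDD} → L ∈ E ++ L ∷ []
∈-last E = ∈-++⁺ʳ E (here refl)

proj-step : ∀ {Φ E L L₁} v (f : Bool → Assignment → Bool) → L₁ ∈ E → v ∈Vars L₁ →
            (∀ z α → ⟦ L₁ ⟧ (α [ v ≔ z ]) ≡ f z α) → (∀ α → ⟦ L ⟧ α ≡ f false α ∨ f true α) →
            Justified Φ E L
proj-step v f L₁∈ v∈ restrict sem =
  proj v L₁∈ v∈ (λ α → trans (sem α) (sym (cong₂ _∨_ (restrict false α) (restrict true α))))

EndsWith : ∀ {A : Set} → List A → A → Set
EndsWith {A} xs x = Σ (List A) λ init → init ++ x ∷ [] ≡ xs

endsWith-++ : ∀ {A : Set} (xs : List A) {ys x} → EndsWith ys x → EndsWith (xs ++ ys) x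
endsWith-++ xs (init , refl) = xs ++ init , ++-assoc xs init _

sum-map-≤ : ∀ {A : Set} (f : A → ℕ) {b xs} → All (λ a → f a ≤ b) xs → sum (map f xs) ≤ length xs * b
sum-map-≤ f []         = z≤n
sum-map-≤ f (fa≤b ∷ p) = +-mono-≤ fa≤b (sum-map-≤ f p)

module BlockOrder (n : ℕ) .{{_ : NonZero n}} where

  -- For v < 4n: ordered by (v mod n, v), so block j = {j, n + j, 2n + j, 3n + j} is contiguous.
  rank : ℕ → ℕ
  rank v = v + v % n * 4 * n

  _≺_ : ℕ → ℕ → Set
  v ≺ w = rank v < rank w

  rank-mod : ∀ v → rank v % n ≡ v % n
  rank-mod v = [m+kn]%n≡m%n v (v % n * 4) n

  rank-injective : Injective _≡_ _≡_ rank
  rank-injective {v} {w} eq = +-cancelʳ-≡ _ v w (trans eq (cong (λ i → w + i * 4 * n) (sym same-block)))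
    where
      same-block : v % n ≡ w % n
      same-block = trans (sym (rank-mod v)) (trans (cong (_% n) eq) (rank-mod w))

  ≺⇒≢ : ∀ {v w} → v ≺ w → v ≢ w
  ≺⇒≢ v≺w refl = <-irrefl refl v≺w

  ≻⇒≢ : ∀ {v w} → w ≺ v → v ≢ w
  ≻⇒≢ w≺v = ≢-sym (≺⇒≢ w≺v)

  record InBlock (v j : ℕ) : Set where
    field
      block    : v % n ≡ j
      below-4n : v < 4 * n
  open InBlock

  inBlock : ∀ k {j} → k < 4 → j < n → InBlock (k * n + j) j
  inBlock k {j} k<4 j<n = record
    { block    = trans (cong (_% n) (+-comm (k * n) j)) (trans ([m+kn]%n≡m%n j k n) (m<n⇒m%n≡m j<n))
    ; below-4n = <-≤-trans (+-monoʳ-< (k * n) j<n)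
                   (≤-trans (≤-reflexive (+-comm (k * n) n)) (*-monoˡ-≤ n k<4))
    }

  ≺-within : ∀ {v w j} → InBlock v j → InBlock w j → v < w → v ≺ w
  ≺-within {v} {w} {j} bv bw v<w rewrite block bv | block bw = +-monoˡ-< (j * 4 * n) v<w

  ≺-across : ∀ {v w i j} → InBlock v i → InBlock w j → i < j → v ≺ w
  ≺-across {v} {w} {i} {j} bv bw i<j rewrite block bv | block bw = begin-strict
    v + i * 4 * n       <⟨ +-monoˡ-< (i * 4 * n) (below-4n bv) ⟩
    4 * n + i * 4 * n   ≡⟨ sym (*-distribʳ-+ n 4 (i * 4)) ⟩
    suc i * 4 * n       ≤⟨ *-monoˡ-≤ n (*-monoˡ-≤ 4 i<j) ⟩
    j * 4 * n           ≤⟨ m≤n+m (j * 4 * n) w ⟩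
    w + j * 4 * n       ∎
    where open ≤-Reasoning

diffTest : ℕ → ℕ → Template
diffTest v w = ifEq v w hole ⊤ᵗ

diffTest-sem : ∀ v w r α → evalᵗ (diffTest v w) r α ≡ (α v xor α w) ∨ r
diffTest-sem v w r α = at diffTest-identity r (α v ∷ α w ∷ [])
  where
    diffTest-identity : Identity 2 (evalᵗ (diffTest 0 1)) (λ r α → (α 0 xor α 1) ∨ r)
    diffTest-identity = by-cases 2 _

-- For a block x u t e, with e′ the e of the previous block (absent in the first block: Q₀, K₀, R₀)
-- and r the value of the hole:
--   P = ¬t ∨ x ≠ u,   Q = P ∧ chain clause,   K = ∃t Q = ¬e′ ∨ x ≠ u ∨ e,
--   H = ¬e ∨ r,       R = K ∧ H,              ∃e R = ¬e′ ∨ x ≠ u ∨ r.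
Pᵗ : (x u t : ℕ) → Template
Pᵗ x u t = ifEq x u (var⁻ t) ⊤ᵗ

Q₀ᵗ : (x u t e : ℕ) → Template
Q₀ᵗ x u t e = ifEq x u (test t (var⁺ e) ⊥ᵗ) (test t (var⁺ e) ⊤ᵗ)

Qᵗ : (e′ x u t e : ℕ) → Template
Qᵗ e′ x u t e = test e′ (Pᵗ x u t) (Q₀ᵗ x u t e)

Qₗᵗ : (e′ x u t : ℕ) → Template
Qₗᵗ e′ x u t = test e′ (Pᵗ x u t) (ifEq x u ⊥ᵗ (var⁺ t))

K₀ᵗ : (x u e : ℕ) → Template
K₀ᵗ x u e = ifEq x u (var⁺ e) ⊤ᵗ

Kᵗ : (e′ x u e : ℕ) → Template
Kᵗ e′ x u e = test e′ ⊤ᵗ (K₀ᵗ x u e)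

Hᵗ : ℕ → Template
Hᵗ e = test e ⊤ᵗ hole

R₀ᵗ : (x u e : ℕ) → Template
R₀ᵗ x u e = ifEq x u (test e ⊥ᵗ hole) (test e ⊤ᵗ hole)

Rᵗ : (e′ x u e : ℕ) → Template
Rᵗ e′ x u e = test e′ (Hᵗ e) (R₀ᵗ x u e)

P-conj : Identity 3 (evalᵗ (Pᵗ 0 1 2))
                    (clauseTemplate (pos 0 ∷ pos 1 ∷ neg 2 ∷ []) ∧ᵗ clauseTemplate (neg 0 ∷ neg 1 ∷ neg 2 ∷ []))
P-conj = by-cases 3 _

Q₀-conj : Identity 4 (evalᵗ (Q₀ᵗ 0 1 2 3)) (Pᵗ 0 1 2 ∧ᵗ clauseTemplate (pos 2 ∷ pos 3 ∷ []))
Q₀-conj = by-cases 4 _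

Q-conj : Identity 5 (evalᵗ (Qᵗ 0 1 2 3 4)) (Pᵗ 1 2 3 ∧ᵗ clauseTemplate (neg 0 ∷ pos 3 ∷ pos 4 ∷ []))
Q-conj = by-cases 5 _

Qₗ-conj : Identity 4 (evalᵗ (Qₗᵗ 0 1 2 3)) (Pᵗ 1 2 3 ∧ᵗ clauseTemplate (neg 0 ∷ pos 3 ∷ []))
Qₗ-conj = by-cases 4 _

K₀-proj : Identity 4 (evalᵗ (K₀ᵗ 0 1 3)) (∃ᵗ 2 (Q₀ᵗ 0 1 2 3))
K₀-proj = by-cases 4 _

K-proj : Identity 5 (evalᵗ (Kᵗ 0 1 2 4)) (∃ᵗ 3 (Qᵗ 0 1 2 3 4))
K-proj = by-cases 5 _

Qₗ-proj : Identity 4 (evalᵗ (Hᵗ 0 ⟪ diffTest 1 2 ⟪ ⊥ᵗ ⟫ ⟫)) (∃ᵗ 3 (Qₗᵗ 0 1 2 3))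
Qₗ-proj = by-cases 4 _

R₀-conj : Identity 3 (evalᵗ (R₀ᵗ 0 1 2)) (K₀ᵗ 0 1 2 ∧ᵗ Hᵗ 2)
R₀-conj = by-cases 3 _

R-conj : Identity 4 (evalᵗ (Rᵗ 0 1 2 3)) (Kᵗ 0 1 2 3 ∧ᵗ Hᵗ 3)
R-conj = by-cases 4 _

R₀-proj : Identity 3 (evalᵗ (diffTest 0 1)) (∃ᵗ 2 (R₀ᵗ 0 1 2))
R₀-proj = by-cases 3 _

R-proj : Identity 4 (evalᵗ (Hᵗ 0 ⟪ diffTest 1 2 ⟫)) (∃ᵗ 3 (Rᵗ 0 1 2 3))
R-proj = by-cases 4 _

module Refutation (m : ℕ) where

  n : ℕ
  n = suc (suc m)

  open BlockOrder n

  x u t e : ℕ → ℕ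
  x j = j
  u j = n + j
  t j = 2 * n + j
  e j = 3 * n + j

  x<u : ∀ j → x j < u j
  x<u j = m<n+m j z<s

  u<t : ∀ j → u j < t j
  u<t j = +-monoˡ-< j (m<m+n n {n + 0} z<s)

  t<e : ∀ j → t j < e j
  t<e j = +-monoˡ-< j (m<n+m (2 * n) {n} z<s)

  module Block {j} (j<n : j < n) where
    x∈ : InBlock (x j) j
    x∈ = inBlock 0 (s≤s z≤n) j<n
    u∈ : InBlock (u j) j
    u∈ = subst (λ v → InBlock (v + j) j) (*-identityˡ n) (inBlock 1 (s≤s (s≤s z≤n)) j<n)
    t∈ : InBlock (t j) j
    t∈ = inBlock 2 (s≤s (s≤s (s≤s z≤n))) j<n
    e∈ : InBlock (e j) j
    e∈ = inBlock 3 ≤-refl j<n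

    x≺u : x j ≺ u j
    x≺u = ≺-within x∈ u∈ (x<u j)
    u≺t : u j ≺ t j
    u≺t = ≺-within u∈ t∈ (u<t j)
    t≺e : t j ≺ e j
    t≺e = ≺-within t∈ e∈ (t<e j)
    u≺e : u j ≺ e j
    u≺e = ≺-within u∈ e∈ (<-trans (u<t j) (t<e j))
    x≺t : x j ≺ t j
    x≺t = ≺-within x∈ t∈ (<-trans (x<u j) (u<t j))
    x≺e : x j ≺ e j
    x≺e = ≺-within x∈ e∈ (<-trans (x<u j) (<-trans (u<t j) (t<e j)))

    x≢t : x j ≢ t j
    x≢t = ≺⇒≢ x≺t
    u≢t : u j ≢ t j
    u≢t = ≺⇒≢ u≺t
    e≢t : e j ≢ t j
    e≢t = ≻⇒≢ t≺e
    x≢e : x j ≢ e j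
    x≢e = ≺⇒≢ x≺e
    u≢e : u j ≢ e j
    u≢e = ≺⇒≢ u≺e

  module Next {j} (j+1<n : suc j < n) where
    private
      module B = Block (<-trans (n<1+n j) j+1<n)
      module B′ = Block j+1<n
    e≺x : e j ≺ x (suc j)
    e≺x = ≺-across B.e∈ B′.x∈ (n<1+n j)
    e≺t : e j ≺ t (suc j)
    e≺t = ≺-across B.e∈ B′.t∈ (n<1+n j)
    e≺e : e j ≺ e (suc j)
    e≺e = ≺-across B.e∈ B′.e∈ (n<1+n j)

    e≢t : e j ≢ t (suc j)
    e≢t = ≺⇒≢ e≺t
    e≢e : e j ≢ e (suc j)
    e≢e = ≺⇒≢ e≺e

  differs : ℕ → Assignment → Bool
  differs i α = α (x i) xor α (u i)

  anyDiffers : ℕ → ℕ → Assignment → Bool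
  anyDiffers lo zero    α = false
  anyDiffers lo (suc c) α = differs lo α ∨ anyDiffers (suc lo) c α

  anyDiffers-snoc : ∀ lo c α → anyDiffers lo (suc c) α ≡ anyDiffers lo c α ∨ differs (lo + c) α
  anyDiffers-snoc lo zero    α rewrite +-identityʳ lo = Boolₚ.∨-comm (differs lo α) false
  anyDiffers-snoc lo (suc c) α = begin
    differs lo α ∨ anyDiffers (suc lo) (suc c) α
      ≡⟨ cong (differs lo α ∨_) (anyDiffers-snoc (suc lo) c α) ⟩
    differs lo α ∨ (anyDiffers (suc lo) c α ∨ differs (suc lo + c) α)
      ≡⟨ sym (Boolₚ.∨-assoc (differs lo α) _ _) ⟩
    anyDiffers lo (suc c) α ∨ differs (suc lo + c) α
      ≡⟨ cong (λ i → anyDiffers lo (suc c) α ∨ differs i α) (sym (+-suc lo c)) ⟩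
    anyDiffers lo (suc c) α ∨ differs (lo + suc c) α
      ∎
    where open ≡-Reasoning

  anyDiffers-≔ : ∀ lo c α {v} z → (∀ {i} → i < lo + c → x i ≢ v × u i ≢ v) →
                 anyDiffers lo c (α [ v ≔ z ]) ≡ anyDiffers lo c α
  anyDiffers-≔ lo zero    α z fresh = refl
  anyDiffers-≔ lo (suc c) α z fresh = cong₂ _∨_
    (cong₂ _xor_ (≔-other α z (proj₁ (fresh lo<end))) (≔-other α z (proj₂ (fresh lo<end))))
    (anyDiffers-≔ (suc lo) c α z (λ i<end → fresh (<-≤-trans i<end (≤-reflexive (sym (+-suc lo c))))))
    where
      lo<end = m<m+n lo z<s

  stack : ∀ {k} → ℕ → (c : ℕ) → Nodes (suc k) → Nodes (suc (c * 5 + k))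
  stack lo zero    B = B
  stack lo (suc c) B = attach (diffTest (x lo) (u lo)) (stack (suc lo) c B) zero

  stack-sem : ∀ {k} lo c (B : Nodes (suc k)) α →
              evalAt (stack lo c B) zero α ≡ anyDiffers lo c α ∨ evalAt B zero α
  stack-sem lo zero    B α = refl
  stack-sem lo (suc c) B α = begin
    evalAt (stack lo (suc c) B) zero α
      ≡⟨ evalAt-root (diffTest (x lo) (u lo)) (stack (suc lo) c B) zero α ⟩
    evalᵗ (diffTest (x lo) (u lo)) (evalAt (stack (suc lo) c B) zero α) α
      ≡⟨ diffTest-sem (x lo) (u lo) _ α ⟩
    differs lo α ∨ evalAt (stack (suc lo) c B) zero α
      ≡⟨ cong (differs lo α ∨_) (stack-sem (suc lo) c B α) ⟩
    differs lo α ∨ (anyDiffers (suc lo) c α ∨ evalAt B zero α)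
      ≡⟨ sym (Boolₚ.∨-assoc (differs lo α) _ _) ⟩
    anyDiffers lo (suc c) α ∨ evalAt B zero α
      ∎
    where open ≡-Reasoning

  u≺stack : ∀ {k} lo c (B : Nodes (suc k)) → suc lo + c ≤ n → ChildOK rank (u lo) (varAt B zero) →
            ChildOK rank (u lo) (varAt (stack (suc lo) c B) zero)
  u≺stack lo zero    B _     u≺B = u≺B
  u≺stack lo (suc c) B end≤n _   = ≺-across (Block.u∈ (<-trans (n<1+n lo) lo+1<n)) (Block.x∈ lo+1<n) (n<1+n lo)
    where
      lo+1<n = <-≤-trans (m<m+n (suc lo) z<s) end≤n

  stack-ordered : ∀ {k} lo c (B : Nodes (suc k)) → lo + c ≤ n → OrderedNodes rank B →
                  (∀ {i} → i < lo + c → ChildOK rank (u i) (varAt B zero)) →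
                  OrderedNodes rank (stack lo c B)
  stack-ordered lo zero    B end≤n oB u≺B = oB
  stack-ordered lo (suc c) B end≤n oB u≺B =
    attach-ordered rank (diffTest (x lo) (u lo)) (stack (suc lo) c B) zero
      (stack-ordered (suc lo) c B end′≤n oB (λ i<end → u≺B (<-≤-trans i<end (≤-reflexive (sym (+-suc lo c))))))
      (x≺u , x≺u , (u≺root , tt , tt , tt) , (tt , u≺root , tt , tt))
    where
      end′≤n : suc lo + c ≤ n
      end′≤n = ≤-trans (≤-reflexive (sym (+-suc lo c))) end≤n
      open Block (<-≤-trans (m<m+n lo z<s) end≤n) using (x≺u)
      u≺root = u≺stack lo c B end′≤n (u≺B (m<m+n lo z<s))

  u-last∈stack : ∀ {k} lo c (B : Nodes (suc k)) → u (lo + c) ∈Nodes stack lo (suc c) B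
  u-last∈stack lo zero    B rewrite +-identityʳ lo = ∈-attach⁺ˡ (diffTest (x lo) (u lo)) B zero (in-lo at-root)
  u-last∈stack lo (suc c) B rewrite +-suc lo c =
    ∈-attach⁺ʳ (diffTest (x lo) (u lo)) (stack (suc lo) (suc c) B) zero (u-last∈stack (suc lo) c B)

  ∈stack⁻ : ∀ {k y} lo c (B : Nodes (suc k)) → y ∈Nodes stack lo c B →
            y ∈Nodes B ⊎ Σ ℕ (λ i → i < lo + c × y ≤ u i)
  ∈stack⁻ lo zero    B y∈ = inj₁ y∈
  ∈stack⁻ lo (suc c) B y∈ with ∈-attach⁻ (diffTest (x lo) (u lo)) (stack (suc lo) c B) zero y∈
  ... | inj₁ at-root          = inj₂ (lo , m<m+n lo z<s , <⇒≤ (x<u lo))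
  ... | inj₁ (in-lo at-root)  = inj₂ (lo , m<m+n lo z<s , ≤-refl)
  ... | inj₁ (in-hi at-root)  = inj₂ (lo , m<m+n lo z<s , ≤-refl)
  ... | inj₂ y∈′ with ∈stack⁻ (suc lo) c B y∈′
  ...   | inj₁ y∈B             = inj₁ y∈B
  ...   | inj₂ (i , i<end , y≤u) = inj₂ (i , <-≤-trans i<end (≤-reflexive (sym (+-suc lo c))) , y≤u)

  Φ : PCNF
  Φ = EQ' n

  posClause negClause midChain : ℕ → Clause
  posClause j = pos (x j) ∷ pos (u j) ∷ neg (t j) ∷ []
  negClause j = neg (x j) ∷ neg (u j) ∷ neg (t j) ∷ []
  midChain  k = neg (e k) ∷ pos (t (suc k)) ∷ pos (e (suc k)) ∷ []

  firstChain lastChain : Clause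
  firstChain = pos (t 0) ∷ pos (e 0) ∷ []
  lastChain  = neg (e m) ∷ pos (t (suc m)) ∷ []

  blockClauses : ℕ → List Clause
  blockClauses j = posClause j ∷ negClause j ∷ []

  posClause∈ : ∀ {j} → j < n → posClause j ∈ matrix Φ
  posClause∈ j<n = ∈-++⁺ˡ (∈-concat⁺′ (here refl) (∈-map⁺ blockClauses (∈-upTo⁺ j<n)))

  negClause∈ : ∀ {j} → j < n → negClause j ∈ matrix Φ
  negClause∈ j<n = ∈-++⁺ˡ (∈-concat⁺′ (there (here refl)) (∈-map⁺ blockClauses (∈-upTo⁺ j<n)))

  firstChain∈ : firstChain ∈ matrix Φ
  firstChain∈ = ∈-++⁺ʳ (concatMap blockClauses (upTo n)) (here refl)

  midChain∈ : ∀ {k} → k < m → midChain k ∈ matrix Φ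
  midChain∈ k<m = ∈-++⁺ʳ (concatMap blockClauses (upTo n)) (there (∈-++⁺ˡ (∈-map⁺ midChain (∈-upTo⁺ k<m))))

  lastChain∈ : lastChain ∈ matrix Φ
  lastChain∈ = ∈-++⁺ʳ (concatMap blockClauses (upTo n)) (there (∈-++⁺ʳ (map midChain (upTo m)) (here refl)))

  All-matrix : ∀ {P : Clause → Set} → (∀ {j} → j < n → All P (blockClauses j)) → P firstChain →
               (∀ {k} → k < m → P (midChain k)) → P lastChain → All P (matrix Φ)
  All-matrix block first mid last =
    All.++⁺ (All.concat⁺ (All.map⁺ (All.map block (All.all-upTo n))))
            (first ∷ All.++⁺ (All.map⁺ (All.map mid (All.all-upTo m))) (last ∷ []))

  stack-≔ : ∀ lo c α {v} z → (∀ {i} → i < lo + c → x i ≢ v × u i ≢ v) →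
            evalAt (stack lo c falseLeaf) zero (α [ v ≔ z ]) ≡ evalAt (stack lo c falseLeaf) zero α
  stack-≔ lo c α z fresh = begin
    evalAt (stack lo c falseLeaf) zero (α [ _ ≔ z ]) ≡⟨ stack-sem lo c falseLeaf _ ⟩
    anyDiffers lo c (α [ _ ≔ z ]) ∨ false          ≡⟨ cong (_∨ false) (anyDiffers-≔ lo c α z fresh) ⟩
    anyDiffers lo c α ∨ false                      ≡⟨ sym (stack-sem lo c falseLeaf α) ⟩
    evalAt (stack lo c falseLeaf) zero α           ∎
    where open ≡-Reasoning

  e-fresh : ∀ {i j} → i < n → x i ≢ e j × u i ≢ e j
  e-fresh {i} {j} i<n = <⇒≢ (<-≤-trans i<n n≤e) , <⇒≢ (<-≤-trans (+-monoʳ-< n i<n) n+n≤e)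
    where
      n+n≤e : n + n ≤ e j
      n+n≤e = ≤-trans (+-monoʳ-≤ n (m≤m+n n (n + 0))) (m≤m+n (3 * n) j)
      n≤e : n ≤ e j
      n≤e = ≤-trans (m≤m+n n n) n+n≤e

  P : ℕ → OBDD
  P j = Pᵗ (x j) (u j) (t j) ⊳ falseLeaf

  Q₀ K₀ R₀ Qₗ : OBDD
  Q₀ = Q₀ᵗ (x 0) (u 0) (t 0) (e 0) ⊳ falseLeaf
  K₀ = K₀ᵗ (x 0) (u 0) (e 0) ⊳ falseLeaf
  R₀ = R₀ᵗ (x 0) (u 0) (e 0) ⊳ stack 1 (suc m) falseLeaf
  Qₗ = Qₗᵗ (e m) (x (suc m)) (u (suc m)) (t (suc m)) ⊳ falseLeaf

  Q K : ℕ → OBDD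
  Q d = Qᵗ (e d) (x (suc d)) (u (suc d)) (t (suc d)) (e (suc d)) ⊳ falseLeaf
  K d = Kᵗ (e d) (x (suc d)) (u (suc d)) (e (suc d)) ⊳ falseLeaf

  -- H j c = ¬eⱼ ∨ (xᵢ ≠ uᵢ for one of the c + 1 blocks i after j); the sweep keeps j + c = m,
  -- so these are all the remaining blocks.
  H R : ℕ → ℕ → OBDD
  H j c = Hᵗ (e j) ⊳ stack (suc j) (suc c) falseLeaf
  R d c = Rᵗ (e d) (x (suc d)) (u (suc d)) (e (suc d)) ⊳ stack (suc (suc d)) (suc c) falseLeaf

  F : ℕ → OBDD
  F k = obdd _ (stack 0 k falseLeaf)

  xorBase : ℕ → Bool → Nodes 4
  xorBase k z = attach (test (x k) (const z) (const (not z))) falseLeaf zero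

  G : ℕ → Bool → OBDD
  G k z = obdd _ (stack 0 k (xorBase k z))

  u-universal : ∀ {k} → k < n → quant Φ (u k) ≡ ∀q
  u-universal {k} k<n = trans
    (cong (λ b → if b then ∃q else (if u k <ᵇ 2 * n then ∀q else ∃q)) (<ᵇ-false (m+n≮m n k)))
    (cong (λ b → if b then ∀q else ∃q) (<ᵇ-true (+-monoʳ-< n (<-≤-trans k<n (m≤m+n n 0)))))

  vars≤u : ∀ {k} y → y ∈Vars F (suc k) → y ≤ u k
  vars≤u {k} y y∈ with ∈stack⁻ 0 (suc k) falseLeaf y∈
  ... | inj₁ (there ())
  ... | inj₂ (i , i<k+1 , y≤u) = ≤-trans y≤u (+-monoʳ-≤ n (s≤s⁻¹ i<k+1))

  G-value : ∀ k z α → ⟦ G k z ⟧ α ≡ anyDiffers 0 k α ∨ (α (x k) xor z)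
  G-value k z α = trans (stack-sem 0 k (xorBase k z) α) (cong (anyDiffers 0 k α ∨_) (if-not≡xor (α (x k)) z))

  G-sem : ∀ k z → k < n → Represents (G k z) (λ α → ⟦ F (suc k) ⟧ (α [ u k ≔ z ]))
  G-sem k z k<n α = begin
    ⟦ G k z ⟧ α                                 ≡⟨ G-value k z α ⟩
    anyDiffers 0 k α ∨ (α (x k) xor z)          ≡⟨ cong₂ (λ a b → a ∨ (b xor z)) (sym (anyDiffers-≔ 0 k α z fresh))
                                                                                 (sym (≔-other α z (<⇒≢ (x<u k)))) ⟩
    anyDiffers 0 k β ∨ (β (x k) xor z)          ≡⟨ cong (λ b → anyDiffers 0 k β ∨ (β (x k) xor b))
                                                     (sym (≔-same α (u k) z)) ⟩
    anyDiffers 0 k β ∨ differs k β              ≡⟨ sym (anyDiffers-snoc 0 k β) ⟩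
    anyDiffers 0 (suc k) β                      ≡⟨ sym (Boolₚ.∨-identityʳ _) ⟩
    anyDiffers 0 (suc k) β ∨ false              ≡⟨ sym (stack-sem 0 (suc k) falseLeaf β) ⟩
    ⟦ F (suc k) ⟧ β                             ∎
    where
      open ≡-Reasoning
      β = α [ u k ≔ z ]
      fresh : ∀ {i} → i < k → x i ≢ u k × u i ≢ u k
      fresh i<k = <⇒≢ (<-≤-trans (<-trans i<k k<n) (m≤m+n n k)) , <⇒≢ (+-monoʳ-< n i<k)

  F-sem : ∀ k α → ⟦ F k ⟧ α ≡ ⟦ G k false ⟧ α ∧ ⟦ G k true ⟧ α
  F-sem k α = begin
    ⟦ F k ⟧ α                                   ≡⟨ stack-sem 0 k falseLeaf α ⟩
    anyDiffers 0 k α ∨ false                    ≡⟨ ∨-xor-split (anyDiffers 0 k α) (α (x k)) ⟩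
    (anyDiffers 0 k α ∨ (α (x k) xor false)) ∧ (anyDiffers 0 k α ∨ (α (x k) xor true))
                                                ≡⟨ sym (cong₂ _∧_ (G-value k false α) (G-value k true α)) ⟩
    ⟦ G k false ⟧ α ∧ ⟦ G k true ⟧ α            ∎
    where open ≡-Reasoning

  module _ {E : List OBDD} where

    P-justified : ∀ j → clauseOBDD (posClause j) ∈ E → clauseOBDD (negClause j) ∈ E → Justified Φ E (P j)
    P-justified j pos∈ neg∈ = conj pos∈ neg∈ (λ α → at P-conj false (α (x j) ∷ α (u j) ∷ α (t j) ∷ []))

    Q₀-justified : P 0 ∈ E → clauseOBDD firstChain ∈ E → Justified Φ E Q₀
    Q₀-justified P∈ C∈ = conj P∈ C∈ (λ α → at Q₀-conj false (α (x 0) ∷ α (u 0) ∷ α (t 0) ∷ α (e 0) ∷ []))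

    Q-justified : ∀ d → P (suc d) ∈ E → clauseOBDD (midChain d) ∈ E → Justified Φ E (Q d)
    Q-justified d P∈ C∈ = conj P∈ C∈ (λ α →
      at Q-conj false (α (e d) ∷ α (x (suc d)) ∷ α (u (suc d)) ∷ α (t (suc d)) ∷ α (e (suc d)) ∷ []))

    Qₗ-justified : P (suc m) ∈ E → clauseOBDD lastChain ∈ E → Justified Φ E Qₗ
    Qₗ-justified P∈ C∈ = conj P∈ C∈ (λ α →
      at Qₗ-conj false (α (e m) ∷ α (x (suc m)) ∷ α (u (suc m)) ∷ α (t (suc m)) ∷ []))

    R₀-justified : K₀ ∈ E → H 0 m ∈ E → Justified Φ E R₀
    R₀-justified K∈ H∈ = conj K∈ H∈ (λ α →
      at R₀-conj (evalAt (stack 1 (suc m) falseLeaf) zero α) (α (x 0) ∷ α (u 0) ∷ α (e 0) ∷ []))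

    R-justified : ∀ d c → K d ∈ E → H (suc d) c ∈ E → Justified Φ E (R d c)
    R-justified d c K∈ H∈ = conj K∈ H∈ (λ α →
      at R-conj (evalAt (stack (suc (suc d)) (suc c) falseLeaf) zero α)
                (α (e d) ∷ α (x (suc d)) ∷ α (u (suc d)) ∷ α (e (suc d)) ∷ []))

    K₀-justified : Q₀ ∈ E → Justified Φ E K₀
    K₀-justified Q₀∈ = proj-step (t 0) restricted Q₀∈
      (∈-attach⁺ˡ (Q₀ᵗ (x 0) (u 0) (t 0) (e 0)) falseLeaf zero (in-lo (in-lo at-root)))
      (λ z α → cong (evalᵗ (Q₀ᵗ 0 1 2 3) false ∘ slot) (Pointwise-≡⇒≡
        (≔-other α z x≢t ∷ ≔-other α z u≢t ∷ ≔-same α (t 0) z ∷ ≔-other α z e≢t ∷ [])))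
      (λ α → at K₀-proj false (values α))
      where
        open Block {0} z<s using (x≢t; u≢t; e≢t)
        values : Assignment → Vec Bool 4
        values α = α (x 0) ∷ α (u 0) ∷ α (t 0) ∷ α (e 0) ∷ []
        restricted : Bool → Assignment → Bool
        restricted z α = evalᵗ (Q₀ᵗ 0 1 2 3) false (slot (values α) [ 2 ≔ z ])

    K-justified : ∀ d → suc d < n → Q d ∈ E → Justified Φ E (K d)
    K-justified d d′<n Q∈ = proj-step (t d′) restricted Q∈
      (∈-attach⁺ˡ (Qᵗ (e d) (x d′) (u d′) (t d′) (e d′)) falseLeaf zero (in-lo (in-lo (in-lo at-root))))
      (λ z α → cong (evalᵗ (Qᵗ 0 1 2 3 4) false ∘ slot) (Pointwise-≡⇒≡
        (≔-other α z e′≢t ∷ ≔-other α z x≢t ∷ ≔-other α z u≢t ∷ ≔-same α (t d′) z ∷ ≔-other α z e≢t ∷ [])))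
      (λ α → at K-proj false (values α))
      where
        d′ = suc d
        open Block d′<n using (x≢t; u≢t; e≢t)
        open Next d′<n renaming (e≢t to e′≢t)
        values : Assignment → Vec Bool 5
        values α = α (e d) ∷ α (x d′) ∷ α (u d′) ∷ α (t d′) ∷ α (e d′) ∷ []
        restricted : Bool → Assignment → Bool
        restricted z α = evalᵗ (Qᵗ 0 1 2 3 4) false (slot (values α) [ 3 ≔ z ])

    Hₗ-justified : Qₗ ∈ E → Justified Φ E (H m 0)
    Hₗ-justified Q∈ = proj-step (t m′) restricted Q∈
      (∈-attach⁺ˡ (Qₗᵗ (e m) (x m′) (u m′) (t m′)) falseLeaf zero (in-lo (in-lo (in-lo at-root))))
      (λ z α → cong (evalᵗ (Qₗᵗ 0 1 2 3) false ∘ slot) (Pointwise-≡⇒≡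
        (≔-other α z e≢t ∷ ≔-other α z x≢t ∷ ≔-other α z u≢t ∷ ≔-same α (t m′) z ∷ [])))
      (λ α → at Qₗ-proj false (values α))
      where
        m′ = suc m
        open Block {m′} ≤-refl using (x≢t; u≢t)
        open Next {m} ≤-refl using (e≢t)
        values : Assignment → Vec Bool 4
        values α = α (e m) ∷ α (x m′) ∷ α (u m′) ∷ α (t m′) ∷ []
        restricted : Bool → Assignment → Bool
        restricted z α = evalᵗ (Qₗᵗ 0 1 2 3) false (slot (values α) [ 3 ≔ z ])

    Fₙ-justified : R₀ ∈ E → Justified Φ E (F n)
    Fₙ-justified R∈ = proj-step (e 0) restricted R∈
      (∈-attach⁺ˡ (R₀ᵗ (x 0) (u 0) (e 0)) S zero (in-lo (in-lo at-root)))
      (λ z α → cong₂ (λ r bs → evalᵗ (R₀ᵗ 0 1 2) r (slot bs)) (stack-≔ 1 (suc m) α z e-fresh)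
        (Pointwise-≡⇒≡ (≔-other α z x≢e ∷ ≔-other α z u≢e ∷ ≔-same α (e 0) z ∷ [])))
      (λ α → at R₀-proj (evalAt S zero α) (values α))
      where
        S = stack 1 (suc m) falseLeaf
        open Block {0} z<s using (x≢e; u≢e)
        values : Assignment → Vec Bool 3
        values α = α (x 0) ∷ α (u 0) ∷ α (e 0) ∷ []
        restricted : Bool → Assignment → Bool
        restricted z α = evalᵗ (R₀ᵗ 0 1 2) (evalAt S zero α) (slot (values α) [ 2 ≔ z ])

    H-justified : ∀ d c → suc (suc d) + suc c ≤ n → R d c ∈ E → Justified Φ E (H d (suc c))
    H-justified d c end≤n R∈ = proj-step (e d′) restricted R∈
      (∈-attach⁺ˡ (Rᵗ (e d) (x d′) (u d′) (e d′)) S zero (in-lo at-root))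
      (λ z α → cong₂ (λ r bs → evalᵗ (Rᵗ 0 1 2 3) r (slot bs))
        (stack-≔ (suc d′) (suc c) α z (λ i<end → e-fresh (<-≤-trans i<end end≤n)))
        (Pointwise-≡⇒≡ (≔-other α z e≢e ∷ ≔-other α z x≢e ∷ ≔-other α z u≢e ∷ ≔-same α (e d′) z ∷ [])))
      (λ α → at R-proj (evalAt S zero α) (values α))
      where
        d′ = suc d
        S = stack (suc d′) (suc c) falseLeaf
        d′<n : d′ < n
        d′<n = ≤-trans (m≤m+n (suc d′) (suc c)) end≤n
        open Block d′<n using (x≢e; u≢e)
        open Next d′<n using (e≢e)
        values : Assignment → Vec Bool 4
        values α = α (e d) ∷ α (x d′) ∷ α (u d′) ∷ α (e d′) ∷ []
        restricted : Bool → Assignment → Bool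
        restricted z α = evalᵗ (Rᵗ 0 1 2 3) (evalAt S zero α) (slot (values α) [ 3 ≔ z ])

    G-justified : ∀ k z → k < n → F (suc k) ∈ E → Justified Φ E (G k z)
    G-justified k z k<n F∈ =
      ured (u k) z F∈ (u-last∈stack 0 k falseLeaf) (u-universal k<n) vars≤u (G-sem k z k<n)

    F-justified : ∀ k → G k false ∈ E → G k true ∈ E → Justified Φ E (F k)
    F-justified k G₀∈ G₁∈ = conj G₀∈ G₁∈ (F-sem k)

  axiomLines : List OBDD
  axiomLines = map clauseOBDD (matrix Φ)

  reductions : ℕ → List OBDD
  reductions zero    = []
  reductions (suc k) = G k false ∷ G k true ∷ F k ∷ reductions k

  sweep : ℕ → ℕ → List OBDD
  sweep zero    c = P 0 ∷ Q₀ ∷ K₀ ∷ R₀ ∷ F n ∷ reductions n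
  sweep (suc d) c = P (suc d) ∷ Q d ∷ K d ∷ R d c ∷ H d (suc c) ∷ sweep d (suc c)

  derivedLines : List OBDD
  derivedLines = P (suc m) ∷ Qₗ ∷ H m 0 ∷ sweep m 0

  axiom∈ : ∀ {E C} → axiomLines ⊆ E → C ∈ matrix Φ → clauseOBDD C ∈ E
  axiom∈ ax C∈ = ax (∈-map⁺ clauseOBDD C∈)

  reductions-steps : ∀ k {E} → k ≤ n → F k ∈ E → Steps Φ E (reductions k)
  reductions-steps zero    _   _  = done
  reductions-steps (suc k) {E} k<n F∈ =
    step (G-justified k false k<n F∈)
    (step (G-justified k true k<n (∈-++⁺ˡ F∈))
    (step (F-justified k (∈-++⁺ˡ (∈-last E)) (∈-last (E ++ _)))
    (reductions-steps k (<⇒≤ k<n) (∈-last ((E ++ _) ++ _)))))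

  sweep-steps : ∀ d c {E} → d + c ≡ m → axiomLines ⊆ E → H d c ∈ E → Steps Φ E (sweep d c)
  sweep-steps zero c {E} refl ax H∈ =
    step (P-justified 0 (axiom∈ ax (posClause∈ z<s)) (axiom∈ ax (negClause∈ z<s)))
    (step (Q₀-justified (∈-last E) (∈-++⁺ˡ (axiom∈ ax firstChain∈)))
    (step (K₀-justified (∈-last (E ++ _)))
    (step (R₀-justified (∈-last ((E ++ _) ++ _)) (∈-++⁺ˡ (∈-++⁺ˡ (∈-++⁺ˡ H∈))))
    (step (Fₙ-justified (∈-last (((E ++ _) ++ _) ++ _)))
    (reductions-steps n ≤-refl (∈-last ((((E ++ _) ++ _) ++ _) ++ _)))))))
  sweep-steps (suc d) c {E} d+c≡m ax H∈ =
    step (P-justified (suc d) (axiom∈ ax (posClause∈ d+1<n)) (axiom∈ ax (negClause∈ d+1<n)))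
    (step (Q-justified d (∈-last E) (∈-++⁺ˡ (axiom∈ ax (midChain∈ d<m))))
    (step (K-justified d d+1<n (∈-last (E ++ _)))
    (step (R-justified d c (∈-last ((E ++ _) ++ _)) (∈-++⁺ˡ (∈-++⁺ˡ (∈-++⁺ˡ H∈))))
    (step (H-justified d c end≤n (∈-last (((E ++ _) ++ _) ++ _)))
    (sweep-steps d (suc c) (trans (+-suc d c) d+c≡m)
      (λ L∈ → ∈-++⁺ˡ (∈-++⁺ˡ (∈-++⁺ˡ (∈-++⁺ˡ (∈-++⁺ˡ (ax L∈))))))
      (∈-last ((((E ++ _) ++ _) ++ _) ++ _)))))))
    where
      d<m : d < m
      d<m = ≤-trans (m≤m+n (suc d) c) (≤-reflexive d+c≡m)
      d+1<n : suc d < n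
      d+1<n = s≤s (m≤n⇒m≤1+n d<m)
      end≤n : suc (suc d) + suc c ≤ n
      end≤n = ≤-reflexive (cong (λ k → suc (suc k)) (trans (+-suc d c) d+c≡m))

  derivedLines-steps : Steps Φ axiomLines derivedLines
  derivedLines-steps =
    step (P-justified (suc m) (axiom∈ ⊆.⊆-refl (posClause∈ ≤-refl)) (axiom∈ ⊆.⊆-refl (negClause∈ ≤-refl)))
    (step (Qₗ-justified (∈-last axiomLines) (∈-++⁺ˡ (axiom∈ ⊆.⊆-refl lastChain∈)))
    (step (Hₗ-justified (∈-last (axiomLines ++ _)))
    (sweep-steps m 0 (+-identityʳ m) (λ L∈ → ∈-++⁺ˡ (∈-++⁺ˡ (∈-++⁺ˡ L∈))) (∈-last ((axiomLines ++ _) ++ _)))))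

  Pᵗ-ordered : ∀ {j} → j < n → OrderedTemplate rank nothing (Pᵗ (x j) (u j) (t j))
  Pᵗ-ordered {j} j<n =
    ifEq-ordered rank {nothing} (x j) (u j) (var⁻ (t j)) ⊤ᵗ x≺u u≺t tt (tt , tt , tt , tt) tt
    where open Block j<n

  Q₀ᵗ-ordered : ∀ {j} → j < n → OrderedTemplate rank nothing (Q₀ᵗ (x j) (u j) (t j) (e j))
  Q₀ᵗ-ordered {j} j<n =
    ifEq-ordered rank {nothing} (x j) (u j) (test (t j) (var⁺ (e j)) ⊥ᵗ) (test (t j) (var⁺ (e j)) ⊤ᵗ)
      x≺u u≺t u≺t (test-t false) (test-t true)
    where
      open Block j<n
      test-t : ∀ b → OrderedTemplate rank nothing (test (t j) (var⁺ (e j)) (const b))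
      test-t _ = t≺e , tt , (tt , tt , tt , tt) , tt

  K₀ᵗ-ordered : ∀ {j} → j < n → OrderedTemplate rank nothing (K₀ᵗ (x j) (u j) (e j))
  K₀ᵗ-ordered {j} j<n =
    ifEq-ordered rank {nothing} (x j) (u j) (var⁺ (e j)) ⊤ᵗ x≺u u≺e tt (tt , tt , tt , tt) tt
    where open Block j<n

  Hᵗ-ordered : ∀ {j} → suc j < n → OrderedTemplate rank (just (x (suc j))) (Hᵗ (e j))
  Hᵗ-ordered j+1<n = tt , e≺x , tt , tt
    where open Next j+1<n

  R₀ᵗ-ordered : ∀ {j} → suc j < n → OrderedTemplate rank (just (x (suc j))) (R₀ᵗ (x j) (u j) (e j))
  R₀ᵗ-ordered {j} j+1<n =
    ifEq-ordered rank {just (x (suc j))} (x j) (u j) (test (e j) ⊥ᵗ hole) (test (e j) ⊤ᵗ hole)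
      x≺u u≺e u≺e (tt , e≺x , tt , tt) (tt , e≺x , tt , tt)
    where
      open Block (<-trans (n<1+n j) j+1<n)
      open Next j+1<n

  record Admissible (L : OBDD) : Set where
    constructor admissible
    field
      ordered : Ordered rank L
      small   : size L ≤ 5 * n + 40

  -- The smallness hypothesis is a closed computation for each concrete τ, discharged by tt.
  size-⊳stack : ∀ τ lo c {b} (B : Nodes (suc b)) → T (above τ 0 + b <ᵇ 40) → c ≤ n →
                size (τ ⊳ stack lo c B) ≤ 5 * n + 40
  size-⊳stack τ lo c {b} B small c≤n = begin
    suc (above τ (c * 5 + b))         ≡⟨ cong suc (above-+ τ (c * 5 + b)) ⟩
    suc (above τ 0 + (c * 5 + b))     ≡⟨ regroup (above τ 0) b c ⟩
    suc (above τ 0 + b) + c * 5       ≤⟨ +-mono-≤ (<ᵇ⇒< _ 40 small) (*-monoˡ-≤ 5 c≤n) ⟩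
    40 + n * 5                        ≡⟨ +-comm 40 (n * 5) ⟩
    n * 5 + 40                        ≡⟨ cong (_+ 40) (*-comm n 5) ⟩
    5 * n + 40                        ∎
    where
      open ≤-Reasoning
      regroup : ∀ a b c → suc (a + (c * 5 + b)) ≡ suc (a + b) + c * 5
      regroup = solve-∀

  ⊳stack-admissible : ∀ τ lo c → lo + c ≤ n → OrderedTemplate rank (varAt (stack lo c falseLeaf) zero) τ →
                      T (above τ 0 + 0 <ᵇ 40) → Admissible (τ ⊳ stack lo c falseLeaf)
  ⊳stack-admissible τ lo c end≤n oτ small =
    admissible (⊳-ordered rank τ (stack-ordered lo c falseLeaf end≤n tt (λ _ → tt)) oτ)
               (size-⊳stack τ lo c falseLeaf small (≤-trans (m≤n+m c lo) end≤n))

  ⊳leaf-admissible : ∀ τ → OrderedTemplate rank nothing τ → T (above τ 0 + 0 <ᵇ 40) → Admissible (τ ⊳ falseLeaf)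
  ⊳leaf-admissible τ = ⊳stack-admissible τ 0 0 z≤n

  clause-admissible : ∀ C → RankSorted rank C → T (above (clauseTemplate C) 0 + 0 <ᵇ 40) →
                      Admissible (clauseOBDD C)
  clause-admissible C sorted = ⊳leaf-admissible (clauseTemplate C) (clauseTemplate-ordered rank C sorted)

  axioms-admissible : All Admissible axiomLines
  axioms-admissible = All.map⁺ (All-matrix
    (λ {j} j<n → let open Block j<n in
      clause-admissible (posClause j) (x≺u ∷ u≺t ∷ [-]) tt ∷
      clause-admissible (negClause j) (x≺u ∷ u≺t ∷ [-]) tt ∷ [])
    (clause-admissible firstChain (Block.t≺e {0} z<s ∷ [-]) tt)
    (λ {k} k<m → let k+1<n = s≤s (m≤n⇒m≤1+n k<m) in
      clause-admissible (midChain k) (Next.e≺t k+1<n ∷ Block.t≺e k+1<n ∷ [-]) tt)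
    (clause-admissible lastChain (Next.e≺t {m} ≤-refl ∷ [-]) tt))

  G-admissible : ∀ k z → k < n → Admissible (G k z)
  G-admissible k z k<n = admissible
    (stack-ordered 0 k (xorBase k z) (<⇒≤ k<n) (tt , tt , tt)
       (λ i<k → ≺-across (Block.u∈ (<-trans i<k k<n)) (Block.x∈ k<n) i<k))
    (size-⊳stack hole 0 k (xorBase k z) tt (<⇒≤ k<n))

  P-admissible : ∀ {j} → j < n → Admissible (P j)
  P-admissible {j} j<n = ⊳leaf-admissible (Pᵗ (x j) (u j) (t j)) (Pᵗ-ordered j<n) tt

  Q₀-admissible : Admissible Q₀
  Q₀-admissible = ⊳leaf-admissible (Q₀ᵗ (x 0) (u 0) (t 0) (e 0)) (Q₀ᵗ-ordered z<s) tt

  Q-admissible : ∀ {d} → suc d < n → Admissible (Q d)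
  Q-admissible {d} d+1<n = ⊳leaf-admissible (Qᵗ (e d) (x (suc d)) (u (suc d)) (t (suc d)) (e (suc d)))
    (e≺x , e≺x , Pᵗ-ordered d+1<n , Q₀ᵗ-ordered d+1<n) tt
    where open Next d+1<n using (e≺x)

  Qₗ-admissible : Admissible Qₗ
  Qₗ-admissible = ⊳leaf-admissible (Qₗᵗ (e m) (x (suc m)) (u (suc m)) (t (suc m)))
    (e≺x , e≺x , Pᵗ-ordered ≤-refl ,
     ifEq-ordered rank {nothing} (x (suc m)) (u (suc m)) ⊥ᵗ (var⁺ (t (suc m)))
       x≺u tt u≺t tt (tt , tt , tt , tt)) tt
    where
      open Next {m} ≤-refl using (e≺x)
      open Block {suc m} ≤-refl using (x≺u; u≺t)

  K₀-admissible : Admissible K₀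
  K₀-admissible = ⊳leaf-admissible (K₀ᵗ (x 0) (u 0) (e 0)) (K₀ᵗ-ordered z<s) tt

  K-admissible : ∀ {d} → suc d < n → Admissible (K d)
  K-admissible {d} d+1<n = ⊳leaf-admissible (Kᵗ (e d) (x (suc d)) (u (suc d)) (e (suc d)))
    (tt , e≺x , tt , K₀ᵗ-ordered d+1<n) tt
    where open Next d+1<n using (e≺x)

  H-admissible : ∀ j c → suc j + suc c ≤ n → Admissible (H j c)
  H-admissible j c end≤n = ⊳stack-admissible (Hᵗ (e j)) (suc j) (suc c) end≤n
    (Hᵗ-ordered (≤-trans (s≤s (s≤s (m≤m+n j c))) (≤-trans (≤-reflexive (sym (cong suc (+-suc j c)))) end≤n))) tt

  R₀-admissible : Admissible R₀
  R₀-admissible = ⊳stack-admissible (R₀ᵗ (x 0) (u 0) (e 0)) 1 (suc m) ≤-refl (R₀ᵗ-ordered (s≤s (s≤s z≤n))) tt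

  R-admissible : ∀ d c → suc (suc d) + suc c ≤ n → Admissible (R d c)
  R-admissible d c end≤n =
    ⊳stack-admissible (Rᵗ (e d) (x (suc d)) (u (suc d)) (e (suc d))) (suc (suc d)) (suc c) end≤n
    (e≺e , e≺x , Hᵗ-ordered d+2<n , R₀ᵗ-ordered d+2<n) tt
    where
      d+2<n : suc (suc d) < n
      d+2<n = <-≤-trans (m<m+n (suc (suc d)) z<s) end≤n
      open Next (<-trans (n<1+n (suc d)) d+2<n) using (e≺x; e≺e)

  F-admissible : ∀ {k} → k ≤ n → Admissible (F k)
  F-admissible {k} k≤n = ⊳stack-admissible hole 0 k k≤n tt tt

  reductions-admissible : ∀ k → k ≤ n → All Admissible (reductions k)
  reductions-admissible zero    _   = []
  reductions-admissible (suc k) k<n =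
    G-admissible k false k<n ∷ G-admissible k true k<n ∷ F-admissible (<⇒≤ k<n) ∷
    reductions-admissible k (<⇒≤ k<n)

  sweep-admissible : ∀ d c → d + c ≡ m → All Admissible (sweep d c)
  sweep-admissible zero c refl =
    P-admissible z<s ∷ Q₀-admissible ∷ K₀-admissible ∷ R₀-admissible ∷ F-admissible ≤-refl ∷
    reductions-admissible n ≤-refl
  sweep-admissible (suc d) c d+c≡m =
    P-admissible d+1<n ∷ Q-admissible d+1<n ∷ K-admissible d+1<n ∷ R-admissible d c end≤n ∷
    H-admissible d (suc c) (≤-trans (≤-reflexive (+-suc (suc d) (suc c))) end≤n) ∷
    sweep-admissible d (suc c) (trans (+-suc d c) d+c≡m)
    where
      end≤n : suc (suc d) + suc c ≤ n
      end≤n = ≤-reflexive (cong (λ k → suc (suc k)) (trans (+-suc d c) d+c≡m))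
      d+1<n : suc d < n
      d+1<n = ≤-trans (s≤s (s≤s (m≤m+n d (suc c)))) end≤n

  derivedLines-admissible : All Admissible derivedLines
  derivedLines-admissible =
    P-admissible ≤-refl ∷ Qₗ-admissible ∷ H-admissible m 0 (≤-reflexive (cong suc (+-comm m 1))) ∷
    sweep-admissible m 0 (+-identityʳ m)

  lines-admissible : All Admissible (axiomLines ++ derivedLines)
  lines-admissible = All.++⁺ axioms-admissible derivedLines-admissible

  derivation : Derivation Φ
  derivation = record
    { ρ        = rank
    ; ρ-inj    = rank-injective
    ; axioms   = axiomLines
    ; derived  = derivedLines
    ; axiomsOK = clauseOBDDs-represent (matrix Φ)
    ; stepsOK  = derivedLines-steps
    ; ordered  = All.map Admissible.ordered lines-admissible
    }

  reductions-end : ∀ k → EndsWith (reductions (suc k)) (F 0)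
  reductions-end zero    = G 0 false ∷ G 0 true ∷ [] , refl
  reductions-end (suc k) = endsWith-++ (G (suc k) false ∷ G (suc k) true ∷ F (suc k) ∷ []) (reductions-end k)

  sweep-end : ∀ d c → EndsWith (sweep d c) (F 0)
  sweep-end zero    c = endsWith-++ (P 0 ∷ Q₀ ∷ K₀ ∷ R₀ ∷ F n ∷ []) (reductions-end (suc m))
  sweep-end (suc d) c = endsWith-++ (P (suc d) ∷ Q d ∷ K d ∷ R d c ∷ H d (suc c) ∷ []) (sweep-end d (suc c))

  refutation : IsRefutation derivation
  refutation with endsWith-++ axiomLines (endsWith-++ (P (suc m) ∷ Qₗ ∷ H m 0 ∷ []) (sweep-end m 0))
  ... | init , init++F₀≡lines = init , F 0 , init++F₀≡lines , λ α → refl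

  blocks-length : ∀ js → length (concatMap blockClauses js) ≡ length js * 2
  blocks-length []       = refl
  blocks-length (j ∷ js) = cong (λ k → suc (suc k)) (blocks-length js)

  reductions-length : ∀ k → length (reductions k) ≡ k * 3
  reductions-length zero    = refl
  reductions-length (suc k) = cong (3 +_) (reductions-length k)

  sweep-length : ∀ d c → length (sweep d c) ≡ d * 5 + (5 + n * 3)
  sweep-length zero    c = cong (5 +_) (reductions-length n)
  sweep-length (suc d) c = cong (5 +_) (sweep-length d (suc c))

  axiomLines-length : length axiomLines ≡ n * 2 + (1 + (m + 1))
  axiomLines-length = begin
    length axiomLines                                          ≡⟨ length-map clauseOBDD (matrix Φ) ⟩
    length (matrix Φ)                                          ≡⟨ length-++ (concatMap blockClauses (upTo n)) ⟩
    length (concatMap blockClauses (upTo n)) + suc (length (map midChain (upTo m) ++ lastChain ∷ []))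
      ≡⟨ cong₂ (λ a b → a + suc b)
           (trans (blocks-length (upTo n)) (cong (_* 2) (length-upTo n)))
           (trans (length-++ (map midChain (upTo m)))
                  (cong (_+ 1) (trans (length-map midChain (upTo m)) (length-upTo m)))) ⟩
    n * 2 + (1 + (m + 1))                                      ∎
    where open ≡-Reasoning

  lines-length : length (lines derivation) + 2 ≡ 11 * n
  lines-length = begin
    length (axiomLines ++ derivedLines) + 2              ≡⟨ cong (_+ 2) (length-++ axiomLines) ⟩
    length axiomLines + length derivedLines + 2          ≡⟨ cong₂ (λ a b → a + (3 + b) + 2)
                                                              axiomLines-length (sweep-length m 0) ⟩
    n * 2 + (1 + (m + 1)) + (3 + (m * 5 + (5 + n * 3))) + 2 ≡⟨ count m ⟩
    11 * n                                               ∎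
    where
      open ≡-Reasoning
      count : ∀ m → let n = suc (suc m) in n * 2 + (1 + (m + 1)) + (3 + (m * 5 + (5 + n * 3))) + 2 ≡ 11 * n
      count = solve-∀

  size-bound : derivationSize derivation ≤ 11 * n * (5 * n + 40)
  size-bound = begin
    derivationSize derivation         ≤⟨ sum-map-≤ size (All.map Admissible.small lines-admissible) ⟩
    length ls * (5 * n + 40)          ≤⟨ *-monoˡ-≤ (5 * n + 40) (m≤m+n (length ls) 2) ⟩
    (length ls + 2) * (5 * n + 40)    ≡⟨ cong (_* (5 * n + 40)) lines-length ⟩
    11 * n * (5 * n + 40)             ∎
    where
      open ≤-Reasoning
      ls = lines derivation

quadratic : ∀ n → 11 * n * (5 * n + 40) ≡ evalPoly (0 ∷ 440 ∷ 55 ∷ []) n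
quadratic n = expand n
  where
    expand : ∀ n → 11 * n * (5 * n + 40) ≡ 0 + n * (440 + n * (55 + n * 0))
    expand = solve-∀

corollary4 : Σ Poly λ p → (n : ℕ) → 2 ≤ n →
    Σ (Derivation (EQ' n)) λ D → IsRefutation D × derivationSize D ≤ evalPoly p n
corollary4 = 0 ∷ 440 ∷ 55 ∷ [] , λ where
  (suc (suc m)) (s≤s (s≤s z≤n)) → let open Refutation m in
    derivation , refutation , ≤-trans size-bound (≤-reflexive (quadratic n))
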